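{- For every $n\geq 1$ there is an orientation of the star with center $v_0$ and leaves $v_1,\ldots,v_n$ (a distar $S_n$) that admits an SA$(2n+2,2)$AL, i.e. a total labeling whose subtractive arc-weights are exactly $2n+2,2n+4,\ldots,4n$.
   Context: A distar $S_n$ is the star $K_{1,n}$ with center $v_0$ and leaves $v_1,\ldots,v_n$, with each edge given a direction. For a digraph $G=(V,A)$, a total labeling is a bijection $\lambda:V\cup A\to\{1,2,\ldots,|V|+|A|\}$. For an arc $xy$ (tail $x$, head $y$), $wt^-(xy)=\lambda(xy)+\lambda(y)-\lambda(x)$. An SA$(a,d)$AL is a total labeling whose set of subtractive arc-weights is $\{a,a+d,\ldots,a+(|A|-1)d\}$ (all distinct). -}

module Defs where

open import Data.Nat using (ℕ; suc; _+_; _*_)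
open import Data.Fin using (Fin; zero; suc; toℕ)
open import Data.Bool using (Bool; true; false)
open import Data.Sum using (_⊎_; inj₁; inj₂)
open import Data.Product using (Σ; ∃; _×_; _,_)
open import Data.Integer using (ℤ; +_; _-_)
import Data.Integer as ℤ
open import Function.Bundles using (_⤖_; Bijection)
open import Relation.Binary.PropositionalEquality using (_≡_)

-- The star K_{1,n}: vertices Fin (suc n), vertex zero = centre v₀,
-- vertex (suc i) = leaf v_{i+1}.  Edges are indexed by leaves i : Fin n,
-- edge i joins v₀ and v_{i+1}.

Orientation : ℕ → Set
Orientation n = Fin n → Bool

tail head : ∀ {n} → Orientation n → Fin n → Fin (suc n)
tail o i with o i
... | true  = zero
... | false = suc i
head o i with o i
... | true  = suc i
... | false = zero

Elem : ℕ → Set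
Elem n = Fin (suc n) ⊎ Fin n

size : ℕ → ℕ
size n = suc n + n

TotalLabeling : ℕ → Set
TotalLabeling n = Elem n ⤖ Fin (size n)

label : ∀ {n} → TotalLabeling n → Elem n → ℤ
label λ' x = + suc (toℕ (Bijection.to λ' x))

wt⁻ : ∀ {n} → Orientation n → TotalLabeling n → Fin n → ℤ
wt⁻ o λ' i = (label λ' (inj₂ i) ℤ.+ label λ' (inj₁ (head o i))) - label λ' (inj₁ (tail o i))

IsSAAL : ∀ {n} → Orientation n → ℤ → ℤ → TotalLabeling n → Set
IsSAAL {n} o a d λ' =
  (∀ i j → wt⁻ o λ' i ≡ wt⁻ o λ' j → i ≡ j)
  × (∀ i → ∃ λ (k : Fin n) → wt⁻ o λ' i ≡ a ℤ.+ (+ toℕ k) ℤ.* d)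
  × (∀ (k : Fin n) → ∃ λ i → wt⁻ o λ' i ≡ a ℤ.+ (+ toℕ k) ℤ.* d)

-- Orient every edge towards the centre and label (from {1, …, 2n+1}) the
-- centre 2n+1, the leaf v_{i+1} by n − i and the arc at it by n + 1 + i.
-- Then wt⁻ = (n + 1 + i) + (2n + 1) − (n − i) = 2n + 2 + 2i, which runs
-- through 2n+2, 2n+4, …, 4n exactly once as i runs through 0, …, n−1.
module Submission where

open import Defs
open import Data.Nat using (ℕ; _≥_; _+_; _*_)
open import Data.Product using (Σ; _,_)
open import Data.Integer using (+_)

open import Algebra.Properties.AbelianGroup using (∙-cancelˡ)
open import Data.Bool using (false)
open import Data.Fin using (Fin; zero; suc; toℕ; opposite; join; cast)
open import Data.Fin.Permutation using (cast-id)
open import Data.Fin.Properties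
  using (toℕ-injective; toℕ<n; toℕ-↑ˡ; toℕ-↑ʳ; toℕ-cast; +↔⊎; opposite-prop; opposite-involutive)
import Data.Integer as ℤ
import Data.Integer.Properties as ℤ
open import Data.List using ([]; _∷_)
import Data.Nat as ℕ
import Data.Nat.Properties as ℕ
open import Data.Nat.Tactic.RingSolver using (solve)
open import Data.Sum using (_⊎_; inj₁; inj₂)
open import Data.Sum.Function.Propositional using (_⊎-↔_)
open import Function.Bundles using (_↔_; mk↔ₛ′)
open import Function.Properties.Inverse using (↔-refl; ↔-sym; ↔-trans; ↔⇒⤖)
open import Relation.Binary.PropositionalEquality

arithmetic-weights⇒IsSAAL : ∀ {n} (o : Orientation n) (lab : TotalLabeling n)
  (a d : ℤ.ℤ) .{{_ : ℤ.NonZero d}} →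
  (∀ i → wt⁻ o lab i ≡ a ℤ.+ + toℕ i ℤ.* d) → IsSAAL o a d lab
arithmetic-weights⇒IsSAAL o lab a d wt≡ = injective , (λ i → i , wt≡ i) , (λ k → k , wt≡ k)
  where
  injective : ∀ i j → wt⁻ o lab i ≡ wt⁻ o lab j → i ≡ j
  injective i j eq = toℕ-injective (ℤ.+-injective (ℤ.*-cancelʳ-≡ _ _ d
    (∙-cancelˡ ℤ.+-0-abelianGroup a _ _ (trans (sym (wt≡ i)) (trans eq (wt≡ j))))))

m+n≡o+k⇒m+n-o≡k : ∀ m n o {k} → m + n ≡ o + k → (+ m ℤ.+ + n) ℤ.- + o ≡ + k
m+n≡o+k⇒m+n-o≡k m n o {k} eq = begin
  + (m + n) ℤ.- + o       ≡⟨ ℤ.m-n≡m⊖n (m + n) o ⟩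
  (m + n) ℤ.⊖ o           ≡⟨ cong₂ ℤ._⊖_ eq (sym (ℕ.+-identityʳ o)) ⟩
  (o + k) ℤ.⊖ (o + 0)     ≡⟨ ℤ.+-cancelˡ-⊖ o k 0 ⟩
  + k                     ∎
  where open ≡-Reasoning

inward-weight-identity : ∀ {n p q} → ℕ.suc (p + q) ≡ n →
  ℕ.suc (n + q) + ℕ.suc (n + n) ≡ ℕ.suc p + (2 * n + 2 + q * 2)
inward-weight-identity {p = p} {q} refl = solve (p ∷ q ∷ [])

1+opposite+toℕ≡n : ∀ {n} (i : Fin n) → ℕ.suc (toℕ (opposite i) + toℕ i) ≡ n
1+opposite+toℕ≡n {n} i = begin
  ℕ.suc (toℕ (opposite i) + toℕ i)     ≡⟨ ℕ.+-suc (toℕ (opposite i)) (toℕ i) ⟨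
  toℕ (opposite i) + ℕ.suc (toℕ i)     ≡⟨ cong (_+ ℕ.suc (toℕ i)) (opposite-prop i) ⟩
  n ℕ.∸ ℕ.suc (toℕ i) + ℕ.suc (toℕ i)  ≡⟨ ℕ.m∸n+n≡m (toℕ<n i) ⟩
  n                                    ∎
  where open ≡-Reasoning

module StarLabelling (n : ℕ) where

  inward : Orientation n
  inward _ = false

  -- Block order of the labels: leaves (in reverse), arcs, centre.
  arrange : Elem n ↔ ((Fin n ⊎ Fin n) ⊎ Fin 1)
  arrange = mk↔ₛ′ to from to∘from from∘to
    where
    to : Elem n → (Fin n ⊎ Fin n) ⊎ Fin 1
    to (inj₁ zero)    = inj₂ zero
    to (inj₁ (suc i)) = inj₁ (inj₁ (opposite i))
    to (inj₂ i)       = inj₁ (inj₂ i)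

    from : (Fin n ⊎ Fin n) ⊎ Fin 1 → Elem n
    from (inj₁ (inj₁ j)) = inj₁ (suc (opposite j))
    from (inj₁ (inj₂ i)) = inj₂ i
    from (inj₂ zero)     = inj₁ zero

    to∘from : ∀ y → to (from y) ≡ y
    to∘from (inj₁ (inj₁ j)) = cong (λ k → inj₁ (inj₁ k)) (opposite-involutive j)
    to∘from (inj₁ (inj₂ i)) = refl
    to∘from (inj₂ zero)     = refl

    from∘to : ∀ x → from (to x) ≡ x
    from∘to (inj₁ zero)    = refl
    from∘to (inj₁ (suc i)) = cong (λ k → inj₁ (suc k)) (opposite-involutive i)
    from∘to (inj₂ i)       = refl

  labelling : TotalLabeling n
  labelling = ↔⇒⤖ (↔-trans arrange (↔-trans (↔-sym +↔⊎ ⊎-↔ ↔-refl)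
                    (↔-trans (↔-sym +↔⊎) (cast-id (ℕ.+-comm (n + n) 1)))))

  label-centre : label labelling (inj₁ zero) ≡ + ℕ.suc (n + n)
  label-centre = cong (λ k → + ℕ.suc k) (begin
    toℕ (cast _ (join (n + n) 1 (inj₂ zero)))  ≡⟨ toℕ-cast _ _ ⟩
    toℕ (join (n + n) 1 (inj₂ zero))           ≡⟨ toℕ-↑ʳ (n + n) zero ⟩
    n + n + 0                                  ≡⟨ ℕ.+-identityʳ (n + n) ⟩
    n + n                                      ∎)
    where open ≡-Reasoning

  label-leaf : ∀ i → label labelling (inj₁ (suc i)) ≡ + ℕ.suc (toℕ (opposite i))
  label-leaf i = cong (λ k → + ℕ.suc k) (begin
    toℕ (cast _ (join (n + n) 1 (inj₁ (join n n (inj₁ (opposite i))))))  ≡⟨ toℕ-cast _ _ ⟩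
    toℕ (join (n + n) 1 (inj₁ (join n n (inj₁ (opposite i)))))           ≡⟨ toℕ-↑ˡ _ 1 ⟩
    toℕ (join n n (inj₁ (opposite i)))                                   ≡⟨ toℕ-↑ˡ (opposite i) n ⟩
    toℕ (opposite i)                                                     ∎)
    where open ≡-Reasoning

  label-arc : ∀ i → label labelling (inj₂ i) ≡ + ℕ.suc (n + toℕ i)
  label-arc i = cong (λ k → + ℕ.suc k) (begin
    toℕ (cast _ (join (n + n) 1 (inj₁ (join n n (inj₂ i)))))  ≡⟨ toℕ-cast _ _ ⟩
    toℕ (join (n + n) 1 (inj₁ (join n n (inj₂ i))))           ≡⟨ toℕ-↑ˡ _ 1 ⟩
    toℕ (join n n (inj₂ i))                                   ≡⟨ toℕ-↑ʳ n i ⟩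
    n + toℕ i                                                 ∎)
    where open ≡-Reasoning

  wt⁻-arithmetic : ∀ i → wt⁻ inward labelling i ≡ + (2 * n + 2) ℤ.+ + toℕ i ℤ.* + 2
  wt⁻-arithmetic i = begin
    (label labelling (inj₂ i) ℤ.+ label labelling (inj₁ zero)) ℤ.- label labelling (inj₁ (suc i))
      ≡⟨ cong₂ ℤ._-_ (cong₂ ℤ._+_ (label-arc i) label-centre) (label-leaf i) ⟩
    (+ ℕ.suc (n + q) ℤ.+ + ℕ.suc (n + n)) ℤ.- + ℕ.suc p
      ≡⟨ m+n≡o+k⇒m+n-o≡k (ℕ.suc (n + q)) (ℕ.suc (n + n)) (ℕ.suc p)
           (inward-weight-identity (1+opposite+toℕ≡n i)) ⟩
    + (2 * n + 2 + q * 2)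
      ≡⟨ cong (ℤ._+_ (+ (2 * n + 2))) (ℤ.pos-* q 2) ⟩
    + (2 * n + 2) ℤ.+ + q ℤ.* + 2
      ∎
    where
    open ≡-Reasoning
    p q : ℕ
    p = toℕ (opposite i)
    q = toℕ i

mainTheorem8 : ∀ (n : ℕ) → n ≥ 1 →
    Σ (Orientation n) λ o → Σ (TotalLabeling n) λ lab →
    IsSAAL o (+ (2 * n + 2)) (+ 2) lab
mainTheorem8 n _ =
  inward , labelling , arithmetic-weights⇒IsSAAL inward labelling (+ (2 * n + 2)) (+ 2) wt⁻-arithmetic
  where open StarLabelling n
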